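{- Let $\mathcal{C}$ be a reduced $(m,n,r)$-scheme with $m=2r$, and let $X,Y\in\mathrm{Fib}(\mathcal{C})$ with $X\ne Y$. Then (i) $d_T=2$ for every $T\in\mathcal{R}_{X,Y}$; (ii) $d_R\in\{1,2,4\}$ for every $R\in\mathcal{R}_X$, and $|\{R\in\mathcal{R}_X:d_R=1\}|=2\,|\{R\in\mathcal{R}_X:d_R=4\}|$.
   Context: A scheme is a pair $\mathcal{C}=(V,\mathcal{R})$, $V$ finite, $\mathcal{R}$ a partition of $V\times V$ into nonempty relations such that $\Delta_V$ is a union of members of $\mathcal{R}$, $\mathcal{R}$ is closed under transposition, and for $R,S,T\in\mathcal{R}$ the number of $w$ with $(u,w)\in R,(w,v)\in S$ is the same for all $(u,v)\in T$. A fiber is a nonempty $X\subseteq V$ with $\Delta_X\in\mathcal{R}$; $\mathcal{R}_{X,Y}=\{R\in\mathcal{R}:R\subseteq X\times Y\}$, $\mathcal{R}_X=\mathcal{R}_{X,X}$. An $(m,n,r)$-scheme is one with $|\mathcal{R}_{X,Y}|=r$ for all fibers $X,Y$, $|X|=m$ for every fiber, and $n$ fibers. For $R\in\mathcal{R}_{X,Y}$, $d_R=|\{y:(x,y)\in R\}|$ for any $x\in X$. A basis relation is thin if each point has exactly one out- and one in-neighbour in it; the scheme is reduced if for distinct fibers $X\ne Y$ no $R\in\mathcal{R}_{X,Y}$ is thin. -}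

module Defs where

open import Data.Nat using (ℕ)
open import Data.Fin using (Fin; _≟_)
open import Data.Fin.Properties using (all?; any?)
open import Data.List using (length; filter)
open import Data.List.Base using (allFin)
open import Data.Product using (_×_; ∃; ∃₂; Σ)
open import Relation.Binary.PropositionalEquality using (_≡_)
open import Relation.Nullary using (¬_; Dec)
open import Relation.Nullary.Decidable using (_×-dec_; _→-dec_)
open import Relation.Unary using (Decidable)

count : ∀ {n} {P : Fin n → Set} → Decidable P → ℕ
count {n} P? = length (filter P? (allFin n))

-- A partition ℛ of V × V (V = Fin N) into k nonempty relations is encoded
-- by a surjective colouring c : V → V → Fin k; relation i is {(u,v) | c u v ≡ i}.
Colouring : ℕ → ℕ → Set
Colouring N k = Fin N → Fin N → Fin k

module _ {N k : ℕ} (c : Colouring N k) where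

  interNum : Fin k → Fin k → Fin N → Fin N → ℕ
  interNum i j u v = count (λ w → (c u w ≟ i) ×-dec (c w v ≟ j))

  record IsScheme : Set where
    field
      nonempty : ∀ i → ∃₂ λ u v → c u v ≡ i
      -- Δ_V is a union of members of ℛ: a relation meeting Δ_V lies inside Δ_V
      diagUnion : ∀ u x y → c x y ≡ c u u → x ≡ y
      transpose : ∀ x y u v → c x y ≡ c u v → c y x ≡ c v u
      regular : ∀ i j u v u′ v′ → c u v ≡ c u′ v′ → interNum i j u v ≡ interNum i j u′ v′

  -- X is a fiber: Δ_X ∈ ℛ. Fibers are identified with the relations
  -- (colours) X that are diagonal; the points of X are those x with c x x ≡ X.
  IsFiber : Fin k → Set
  IsFiber X = ∃ λ x → c x x ≡ X

  isFiber? : Decidable IsFiber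
  isFiber? X = any? (λ x → c x x ≟ X)

  _∈F_ : Fin N → Fin k → Set
  x ∈F X = c x x ≡ X

  InRel : Fin k → Fin k → Fin k → Set
  InRel X Y R = ∀ x y → c x y ≡ R → (c x x ≡ X) × (c y y ≡ Y)

  inRel? : ∀ X Y → Decidable (InRel X Y)
  inRel? X Y R = all? (λ x → all? (λ y → (c x y ≟ R) →-dec ((c x x ≟ X) ×-dec (c y y ≟ Y))))

  deg : Fin N → Fin k → ℕ
  deg x R = count (λ y → c x y ≟ R)

  indeg : Fin N → Fin k → ℕ
  indeg y R = count (λ x → c x y ≟ R)

  Thin : Fin k → Set
  Thin R = ∀ u v → c u v ≡ R → (deg u R ≡ 1) × (indeg v R ≡ 1)

  record IsMNRScheme (m n r : ℕ) : Set where
    field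
      scheme   : IsScheme
      relCount : ∀ X Y → IsFiber X → IsFiber Y → count (inRel? X Y) ≡ r
      fibSize  : ∀ X → IsFiber X → count (λ x → c x x ≟ X) ≡ m
      fibCount : count isFiber? ≡ n

  IsReduced : Set
  IsReduced = ∀ X Y → IsFiber X → IsFiber Y → ¬ (X ≡ Y) → ∀ R → InRel X Y R → ¬ Thin R

module Submission where

-- The module HalfScheme fixes the setting of the lemma.
-- (i) For x ∈ X the r valencies d_T, T ∈ ℛ_{X,Y}, add up to |Y| = m = 2r.  Each is ≥ 2: it is
--     positive, and d_T = 1 would make T thin, against reducedness.  Hence all equal 2.
-- (ii) For R ∈ ℛ_X pick an R-neighbour x' of x and y₀ ∈ Y.  By (i) exactly 4 paths leave x
--     along the colours of (x, y₀) and then (y₀, x'); by regularity each R-neighbour of x receives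
--     equally many and x' at least one, so d_R ≤ 4.  If d_R = 3, the one remaining path ends at the
--     unique neighbour of x of its colour, which must then receive both paths — a contradiction.
--     The count follows from Σ_{R ∈ ℛ_X} d_R = |X| = 2r = 2·|ℛ_X| together with d_R ∈ {1,2,4}.

open import Defs
open import Data.Nat using (ℕ; zero; suc; _+_; _*_; _∸_; _≤_; _<_; z≤n; s≤s; >-nonZero; _≟_)
open import Data.Nat.Properties
  using (+-*-semiring; +-comm; ≤-refl; ≤-trans; ≤-antisym; ≤-reflexive; <-irrefl; +-mono-≤; +-monoˡ-≤;
         +-monoʳ-≤; +-cancelˡ-≤; +-cancelʳ-≤; +-cancelˡ-≡; m≤m+n; m≤n+m; +-identityʳ; *-identityˡ; *-comm;
         *-cancelˡ-≡; *-monoʳ-≤; m≤m*n; m≤n⇒m<n∨m≡n; m+[n∸m]≡n; module ≤-Reasoning)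
open import Data.Fin as Fin using (Fin; zero; suc)
open import Data.Fin.Properties using (suc-injective)
open import Data.List using (length; filter; tabulate)
open import Data.Product using (_×_; _,_; ∃; proj₁; proj₂)
open import Data.Sum using (_⊎_; inj₁; inj₂)
open import Relation.Nullary using (¬_; Dec; yes; no; contradiction)
open import Relation.Nullary.Decidable using (_×-dec_)
open import Relation.Unary using (Decidable)
open import Relation.Binary.PropositionalEquality using (_≡_; _≢_; refl; sym; trans; cong; cong₂; subst; module ≡-Reasoning)
open import Algebra.Properties.Semiring.Sum +-*-semiring
  using (sum; sum-cong-≗; ∑-distrib-+; ∑-comm; *-distribˡ-sum; *-distribʳ-sum; sum-replicate-zero)

𝟙 : ∀ {P : Set} → Dec P → ℕ
𝟙 (yes _) = 1
𝟙 (no _)  = 0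

module _ {P : Set} where
  𝟙-yes : (d : Dec P) → P → 𝟙 d ≡ 1
  𝟙-yes (yes _) _ = refl
  𝟙-yes (no ¬p) p = contradiction p ¬p

  𝟙-no : (d : Dec P) → ¬ P → 𝟙 d ≡ 0
  𝟙-no (yes p) ¬p = contradiction p ¬p
  𝟙-no (no _)  _  = refl

  𝟙-pos : (d : Dec P) → 0 < 𝟙 d → P
  𝟙-pos (yes p) _  = p
  𝟙-pos (no _)  ()

  𝟙-⇔ : ∀ {Q : Set} (d : Dec P) (e : Dec Q) → (P → Q) → (Q → P) → 𝟙 d ≡ 𝟙 e
  𝟙-⇔ (yes _) (yes _) _ _ = refl
  𝟙-⇔ (yes p) (no ¬q) f _ = contradiction (f p) ¬q
  𝟙-⇔ (no ¬p) (yes q) _ g = contradiction (g q) ¬p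
  𝟙-⇔ (no _)  (no _)  _ _ = refl

  𝟙-× : ∀ {Q : Set} (d : Dec P) (e : Dec Q) → 𝟙 (d ×-dec e) ≡ 𝟙 d * 𝟙 e
  𝟙-× (yes _) (yes _) = refl
  𝟙-× (yes _) (no _)  = refl
  𝟙-× (no _)  _       = refl

  𝟙-*-mono : ∀ {a b} (d : Dec P) → (P → a ≤ b) → 𝟙 d * a ≤ 𝟙 d * b
  𝟙-*-mono (yes p) a≤b = +-mono-≤ (a≤b p) z≤n
  𝟙-*-mono (no _)  _   = z≤n

  𝟙-*-cancel : ∀ {a b} (d : Dec P) → P → 𝟙 d * a ≡ 𝟙 d * b → a ≡ b
  𝟙-*-cancel {a} {b} d p eq = begin
    a          ≡⟨ *-identityˡ a ⟨
    1 * a      ≡⟨ cong (_* a) (𝟙-yes d p) ⟨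
    𝟙 d * a    ≡⟨ eq ⟩
    𝟙 d * b    ≡⟨ cong (_* b) (𝟙-yes d p) ⟩
    1 * b      ≡⟨ *-identityˡ b ⟩
    b          ∎
    where open ≡-Reasoning

sum-mono : ∀ {n} {f g : Fin n → ℕ} → (∀ i → f i ≤ g i) → sum f ≤ sum g
sum-mono {zero}  _   = z≤n
sum-mono {suc n} f≤g = +-mono-≤ (f≤g zero) (sum-mono (λ i → f≤g (suc i)))

+-tight : ∀ {a b c d} → a ≤ b → c ≤ d → a + c ≡ b + d → a ≡ b × c ≡ d
+-tight {a} {b} {c} {d} a≤b c≤d eq =
    ≤-antisym a≤b (+-cancelʳ-≤ d b a (subst (_≤ a + d) eq (+-monoʳ-≤ a c≤d)))
  , ≤-antisym c≤d (+-cancelˡ-≤ b d c (subst (_≤ b + c) eq (+-monoˡ-≤ c a≤b)))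

sum-mono-≡ : ∀ {n} {f g : Fin n → ℕ} → (∀ i → f i ≤ g i) → sum f ≡ sum g → ∀ i → f i ≡ g i
sum-mono-≡ {suc n} f≤g Σf≡Σg i
  with +-tight (f≤g zero) (sum-mono (λ j → f≤g (suc j))) Σf≡Σg
sum-mono-≡ {suc n} f≤g Σf≡Σg zero    | head≡ , _     = head≡
sum-mono-≡ {suc n} f≤g Σf≡Σg (suc i) | _     , tail≡ = sum-mono-≡ (λ j → f≤g (suc j)) tail≡ i

term≤sum : ∀ {n} (f : Fin n → ℕ) i → f i ≤ sum f
term≤sum f zero    = m≤m+n (f zero) _
term≤sum f (suc i) = ≤-trans (term≤sum (λ j → f (suc j)) i) (m≤n+m _ (f zero))

terms≤sum : ∀ {n} (f : Fin n → ℕ) {i j} → i ≢ j → f i + f j ≤ sum f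
terms≤sum f {zero}  {zero}  i≢j = contradiction refl i≢j
terms≤sum f {zero}  {suc j} _   = +-mono-≤ (≤-refl {f zero}) (term≤sum (λ j → f (suc j)) j)
terms≤sum f {suc i} {zero}  _   = subst (_≤ sum f) (+-comm (f zero) (f (suc i)))
  (+-mono-≤ (≤-refl {f zero}) (term≤sum (λ j → f (suc j)) i))
terms≤sum f {suc i} {suc j} i≢j =
  ≤-trans (terms≤sum (λ j → f (suc j)) (λ i≡j → i≢j (cong suc i≡j))) (m≤n+m _ (f zero))

sum-pos : ∀ {n} (f : Fin n → ℕ) → 0 < sum f → ∃ λ i → 0 < f i
sum-pos {suc n} f pos with f zero in eq
... | suc _ = zero , subst (0 <_) (sym eq) (s≤s z≤n)
... | zero  = let (i , fi>0) = sum-pos (λ j → f (suc j)) pos in suc i , fi>0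

sum≡1 : ∀ {n} (f : Fin n → ℕ) → sum f ≡ 1 → ∃ λ i → f i ≡ 1 × (∀ j → 0 < f j → j ≡ i)
sum≡1 f Σf≡1 = i , fi≡1 , unique
  where
  positive : ∃ λ i → 0 < f i
  positive = sum-pos f (subst (0 <_) (sym Σf≡1) (s≤s z≤n))
  i : Fin _
  i = proj₁ positive
  fi≡1 : f i ≡ 1
  fi≡1 = ≤-antisym (subst (f i ≤_) Σf≡1 (term≤sum f i)) (proj₂ positive)
  unique : ∀ j → 0 < f j → j ≡ i
  unique j fj>0 with j Fin.≟ i
  ... | yes j≡i = j≡i
  ... | no  j≢i = contradiction 1<1 (<-irrefl refl)
    where
    1<1 : 1 < 1
    1<1 = ≤-trans (+-mono-≤ fj>0 (≤-reflexive (sym fi≡1))) (subst (f j + f i ≤_) Σf≡1 (terms≤sum f j≢i))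

sum-point : ∀ {n} (a : Fin n) (g : Fin n → ℕ) → sum (λ j → 𝟙 (a Fin.≟ j) * g j) ≡ g a
sum-point {suc n} zero g = begin
    1 * g zero + sum {n} (λ _ → 0)  ≡⟨ cong (1 * g zero +_) (sum-replicate-zero n) ⟩
    1 * g zero + 0                  ≡⟨ +-identityʳ _ ⟩
    1 * g zero                      ≡⟨ *-identityˡ _ ⟩
    g zero                          ∎
  where open ≡-Reasoning
sum-point {suc n} (suc a) g = begin
    sum (λ j → 𝟙 (suc a Fin.≟ suc j) * g (suc j))
  ≡⟨ sum-cong-≗ (λ j → cong (_* g (suc j)) (𝟙-⇔ (suc a Fin.≟ suc j) (a Fin.≟ j) suc-injective (cong suc))) ⟩
    sum (λ j → 𝟙 (a Fin.≟ j) * g (suc j))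
  ≡⟨ sum-point a (λ j → g (suc j)) ⟩
    g (suc a) ∎
  where open ≡-Reasoning

count-sum : ∀ {n} {P : Fin n → Set} (P? : Decidable P) → count P? ≡ sum (λ i → 𝟙 (P? i))
count-sum {n} P? = length-filter-tabulate (λ i → i)
  where
  length-filter-tabulate : ∀ {m} (f : Fin m → Fin n) → length (filter P? (tabulate f)) ≡ sum (λ i → 𝟙 (P? (f i)))
  length-filter-tabulate {zero} f = refl
  length-filter-tabulate {suc m} f with P? (f zero)
  ... | yes _ = cong suc (length-filter-tabulate (λ i → f (suc i)))
  ... | no _  = length-filter-tabulate (λ i → f (suc i))

count-pos : ∀ {n} {P : Fin n → Set} (P? : Decidable P) i → P i → 0 < count P?
count-pos P? i p = subst (0 <_) (sym (count-sum P?))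
  (≤-trans (≤-reflexive (sym (𝟙-yes (P? i) p))) (term≤sum (λ j → 𝟙 (P? j)) i))

count-witness : ∀ {n} {P : Fin n → Set} (P? : Decidable P) → 0 < count P? → ∃ P
count-witness P? pos =
  let (i , 𝟙>0) = sum-pos (λ j → 𝟙 (P? j)) (subst (0 <_) (count-sum P?) pos) in i , 𝟙-pos (P? i) 𝟙>0

count-⇔ : ∀ {n} {P Q : Fin n → Set} (P? : Decidable P) (Q? : Decidable Q)
  → (∀ i → P i → Q i) → (∀ i → Q i → P i) → count P? ≡ count Q?
count-⇔ P? Q? P⇒Q Q⇒P = begin
  count P?                  ≡⟨ count-sum P? ⟩
  sum (λ i → 𝟙 (P? i))     ≡⟨ sum-cong-≗ (λ i → 𝟙-⇔ (P? i) (Q? i) (P⇒Q i) (Q⇒P i)) ⟩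
  sum (λ i → 𝟙 (Q? i))     ≡⟨ count-sum Q? ⟨
  count Q?                  ∎
  where open ≡-Reasoning

3*a≤4⇒a≡1 : ∀ {a} → 0 < a → 3 * a ≤ 4 → a ≡ 1
3*a≤4⇒a≡1 {suc zero}    _ _   = refl
3*a≤4⇒a≡1 {suc (suc a)} _ 3a≤4 with ≤-trans (*-monoʳ-≤ 3 (s≤s (s≤s (z≤n {a})))) 3a≤4
... | s≤s (s≤s (s≤s (s≤s ())))

one-two-four : ∀ {d} → 0 < d → d ≤ 4 → d ≢ 3 → d ≡ 1 ⊎ d ≡ 2 ⊎ d ≡ 4
one-two-four {1} _ _ _   = inj₁ refl
one-two-four {2} _ _ _   = inj₂ (inj₁ refl)
one-two-four {3} _ _ d≢3 = contradiction refl d≢3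
one-two-four {4} _ _ _   = inj₂ (inj₂ refl)
one-two-four {suc (suc (suc (suc (suc _))))} _ (s≤s (s≤s (s≤s (s≤s ())))) _

valency-weights : ∀ {P : Set} (p : Dec P) d → (P → d ≡ 1 ⊎ d ≡ 2 ⊎ d ≡ 4)
  → 2 * 𝟙 p + 2 * 𝟙 (p ×-dec (d ≟ 4)) ≡ 𝟙 p * d + 𝟙 (p ×-dec (d ≟ 1))
valency-weights (no _)  _ _ = refl
valency-weights (yes p) d d∈124 with d∈124 p
... | inj₁ refl        = refl
... | inj₂ (inj₁ refl) = refl
... | inj₂ (inj₂ refl) = refl

module SchemeFacts {N k : ℕ} (c : Colouring N k) (sch : IsScheme c) where
  open IsScheme sch

  ∣_∣ : Fin k → ℕ
  ∣ X ∣ = count (λ w → c w w Fin.≟ X)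

  interNum-sum : ∀ i j u v → interNum c i j u v ≡ sum (λ w → 𝟙 (c u w Fin.≟ i) * 𝟙 (c w v Fin.≟ j))
  interNum-sum i j u v = trans (count-sum (λ w → (c u w Fin.≟ i) ×-dec (c w v Fin.≟ j)))
    (sum-cong-≗ (λ w → 𝟙-× (c u w Fin.≟ i) (c w v Fin.≟ j)))

  path→interNum : ∀ {i j u v} w → c u w ≡ i → c w v ≡ j → 0 < interNum c i j u v
  path→interNum w uw vw = count-pos (λ w → (c _ w Fin.≟ _) ×-dec (c w _ Fin.≟ _)) w (uw , vw)

  interNum→path : ∀ {i j u v} → 0 < interNum c i j u v → ∃ λ w → c u w ≡ i × c w v ≡ j
  interNum→path = count-witness (λ w → (c _ w Fin.≟ _) ×-dec (c w _ Fin.≟ _))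

  -- The colour of a pair determines the fibers of its endpoints: (u,v) has the path
  -- u → u → v of colours (c u u, c u v), hence by regularity so does (a,b), and its
  -- middle point is a because the diagonal colour c u u lies in Δ.
  source-fiber : ∀ {a b u v} → c a b ≡ c u v → c a a ≡ c u u
  source-fiber {a} {b} {u} {v} ab≡uv =
    let (w , aw , _) = interNum→path (subst (0 <_) (regular (c u u) (c u v) u v a b (sym ab≡uv))
                                                   (path→interNum u refl refl))
    in subst (λ z → c a z ≡ c u u) (sym (diagUnion u a w aw)) aw

  target-fiber : ∀ {a b u v} → c a b ≡ c u v → c b b ≡ c v v
  target-fiber ab≡uv = source-fiber (transpose _ _ _ _ ab≡uv)

  colour-InRel : ∀ {X Y x y} → c x x ≡ X → c y y ≡ Y → InRel c X Y (c x y)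
  colour-InRel x∈X y∈Y a b ab≡xy = trans (source-fiber ab≡xy) x∈X , trans (target-fiber ab≡xy) y∈Y

  InRel-transpose : ∀ {X Y a b} → InRel c X Y (c a b) → InRel c Y X (c b a)
  InRel-transpose {a = a} {b} R∈XY u v uv≡ba = let (v∈X , u∈Y) = R∈XY v u (transpose u v b a uv≡ba) in u∈Y , v∈X

  indeg≡deg-transpose : ∀ {a b} y → indeg c y (c a b) ≡ deg c y (c b a)
  indeg≡deg-transpose {a} {b} y = count-⇔ (λ w → c w y Fin.≟ c a b) (λ w → c y w Fin.≟ c b a)
    (λ w → transpose w y a b) (λ w → transpose y w b a)

  -- d_R at x counts the R-Rᵗ paths from x back to itself, so it only depends on the fiber of x.
  deg-const : ∀ {x x'} R → c x x ≡ c x' x' → deg c x R ≡ deg c x' R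
  deg-const {x} {x'} R xx≡x'x' with nonempty R
  ... | (a , b , ab≡R) = begin
      deg c x R                    ≡⟨ deg≡returns x ⟩
      interNum c R (c b a) x x     ≡⟨ regular R (c b a) x x x' x' xx≡x'x' ⟩
      interNum c R (c b a) x' x'   ≡⟨ deg≡returns x' ⟨
      deg c x' R                   ∎
    where
    open ≡-Reasoning
    deg≡returns : ∀ z → deg c z R ≡ interNum c R (c b a) z z
    deg≡returns z = count-⇔ (λ w → c z w Fin.≟ R) (λ w → (c z w Fin.≟ R) ×-dec (c w z Fin.≟ c b a))
      (λ w zw≡R → zw≡R , transpose z w a b (trans zw≡R (sym ab≡R))) (λ w → proj₁)

  -- Summing d_R over all points: only the ∣X∣ points of the source fiber contribute, each d_R.
  deg-sum : ∀ {X Y R x} → InRel c X Y R → c x x ≡ X → sum (λ w → deg c w R) ≡ ∣ X ∣ * deg c x R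
  deg-sum {X} {Y} {R} {x} R∈XY x∈X = begin
      sum (λ w → deg c w R)                   ≡⟨ sum-cong-≗ degree ⟩
      sum (λ w → 𝟙 (c w w Fin.≟ X) * deg c x R) ≡⟨ *-distribʳ-sum (deg c x R) (λ w → 𝟙 (c w w Fin.≟ X)) ⟨
      sum (λ w → 𝟙 (c w w Fin.≟ X)) * deg c x R ≡⟨ cong (_* deg c x R) (count-sum (λ w → c w w Fin.≟ X)) ⟨
      ∣ X ∣ * deg c x R                       ∎
    where
    open ≡-Reasoning
    degree : ∀ w → deg c w R ≡ 𝟙 (c w w Fin.≟ X) * deg c x R
    degree w with c w w Fin.≟ X
    ... | yes w∈X = trans (deg-const R (trans w∈X (sym x∈X))) (sym (+-identityʳ _))
    ... | no  w∉X = trans (count-sum (λ z → c w z Fin.≟ R)) (trans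
        (sum-cong-≗ (λ z → 𝟙-no (c w z Fin.≟ R) (λ wz≡R → w∉X (proj₁ (R∈XY w z wz≡R)))))
        (sum-replicate-zero N))

  handshake : ∀ R → sum (λ w → deg c w R) ≡ sum (λ w → indeg c w R)
  handshake R = begin
      sum (λ w → deg c w R)                              ≡⟨ sum-cong-≗ (λ w → count-sum (λ z → c w z Fin.≟ R)) ⟩
      sum (λ w → sum (λ z → 𝟙 (c w z Fin.≟ R)))          ≡⟨ ∑-comm (λ w z → 𝟙 (c w z Fin.≟ R)) ⟩
      sum (λ z → sum (λ w → 𝟙 (c w z Fin.≟ R)))          ≡⟨ sum-cong-≗ (λ z → count-sum (λ w → c w z Fin.≟ R)) ⟨
      sum (λ z → indeg c z R)                            ∎
    where open ≡-Reasoning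

  balance : ∀ {X Y R x y} → InRel c X Y R → c x x ≡ X → c y y ≡ Y
    → ∣ X ∣ * deg c x R ≡ ∣ Y ∣ * indeg c y R
  balance {X} {Y} {R} {x} {y} R∈XY x∈X y∈Y with nonempty R
  ... | (a , b , refl) = begin
      ∣ X ∣ * deg c x (c a b)          ≡⟨ deg-sum R∈XY x∈X ⟨
      sum (λ w → deg c w (c a b))      ≡⟨ handshake (c a b) ⟩
      sum (λ w → indeg c w (c a b))    ≡⟨ sum-cong-≗ indeg≡deg-transpose ⟩
      sum (λ w → deg c w (c b a))      ≡⟨ deg-sum (InRel-transpose R∈XY) y∈Y ⟩
      ∣ Y ∣ * deg c y (c b a)          ≡⟨ cong (∣ Y ∣ *_) (indeg≡deg-transpose y) ⟨
      ∣ Y ∣ * indeg c y (c a b)        ∎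
    where open ≡-Reasoning

  -- Σ_{T ∈ ℛ_{X,Y}} d_T = |Y|: every point of Y is reached from x by exactly one such T.
  valency : ∀ {X Y x} → c x x ≡ X → sum (λ T → 𝟙 (inRel? c X Y T) * deg c x T) ≡ ∣ Y ∣
  valency {X} {Y} {x} x∈X = begin
      sum (λ T → 𝟙 (I T) * deg c x T)
    ≡⟨ sum-cong-≗ (λ T → trans (cong (𝟙 (I T) *_) (count-sum (λ w → c x w Fin.≟ T)))
                                (*-distribˡ-sum (𝟙 (I T)) (λ w → 𝟙 (c x w Fin.≟ T)))) ⟩
      sum (λ T → sum (λ w → 𝟙 (I T) * 𝟙 (c x w Fin.≟ T)))
    ≡⟨ ∑-comm (λ T w → 𝟙 (I T) * 𝟙 (c x w Fin.≟ T)) ⟩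
      sum (λ w → sum (λ T → 𝟙 (I T) * 𝟙 (c x w Fin.≟ T)))
    ≡⟨ sum-cong-≗ (λ w → trans (sum-cong-≗ (λ T → *-comm (𝟙 (I T)) _)) (sum-point (c x w) (λ T → 𝟙 (I T)))) ⟩
      sum (λ w → 𝟙 (I (c x w)))
    ≡⟨ sum-cong-≗ (λ w → 𝟙-⇔ (I (c x w)) (c w w Fin.≟ Y) (λ xw∈XY → proj₂ (xw∈XY x w refl)) (colour-InRel x∈X)) ⟩
      sum (λ w → 𝟙 (c w w Fin.≟ Y))
    ≡⟨ count-sum (λ w → c w w Fin.≟ Y) ⟨
      ∣ Y ∣
    ∎
    where
    open ≡-Reasoning
    I : Decidable (InRel c X Y)
    I = inRel? c X Y

  deg-pos : ∀ {X Y R x} → InRel c X Y R → c x x ≡ X → 0 < deg c x R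
  deg-pos {R = R} {x} R∈XY x∈X with nonempty R
  ... | (a , b , ab≡R) = subst (0 <_) (deg-const R (trans (proj₁ (R∈XY a b ab≡R)) (sym x∈X)))
                                      (count-pos (λ w → c a w Fin.≟ R) b ab≡R)

  paths-from : ∀ {i j u e} → (∀ w → c u w ≡ i → deg c w j ≡ e)
    → sum (λ z → interNum c i j u z) ≡ deg c u i * e
  paths-from {i} {j} {u} {e} middle = begin
      sum (λ z → interNum c i j u z)
    ≡⟨ sum-cong-≗ (interNum-sum i j u) ⟩
      sum (λ z → sum (λ w → 𝟙 (c u w Fin.≟ i) * 𝟙 (c w z Fin.≟ j)))
    ≡⟨ ∑-comm (λ z w → 𝟙 (c u w Fin.≟ i) * 𝟙 (c w z Fin.≟ j)) ⟩
      sum (λ w → sum (λ z → 𝟙 (c u w Fin.≟ i) * 𝟙 (c w z Fin.≟ j)))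
    ≡⟨ sum-cong-≗ (λ w → *-distribˡ-sum (𝟙 (c u w Fin.≟ i)) (λ z → 𝟙 (c w z Fin.≟ j))) ⟨
      sum (λ w → 𝟙 (c u w Fin.≟ i) * sum (λ z → 𝟙 (c w z Fin.≟ j)))
    ≡⟨ sum-cong-≗ continue ⟩
      sum (λ w → 𝟙 (c u w Fin.≟ i) * e)
    ≡⟨ *-distribʳ-sum e (λ w → 𝟙 (c u w Fin.≟ i)) ⟨
      sum (λ w → 𝟙 (c u w Fin.≟ i)) * e
    ≡⟨ cong (_* e) (count-sum (λ w → c u w Fin.≟ i)) ⟨
      deg c u i * e
    ∎
    where
    open ≡-Reasoning
    continue : ∀ w → 𝟙 (c u w Fin.≟ i) * sum (λ z → 𝟙 (c w z Fin.≟ j)) ≡ 𝟙 (c u w Fin.≟ i) * e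
    continue w with c u w Fin.≟ i
    ... | yes uw≡i = cong (_+ 0) (trans (sym (count-sum (λ z → c w z Fin.≟ j))) (middle w uw≡i))
    ... | no  _    = refl

  unique-target : ∀ {i j x u} → (∀ u' → c x u' ≡ c x u → u' ≡ u) → 0 < interNum c i j x u
    → interNum c i j x u ≡ deg c x i
  unique-target {i} {j} {x} {u} unique path with interNum→path path
  ... | (y , xy≡i , yu≡j) = count-⇔ (λ w → (c x w Fin.≟ i) ×-dec (c w u Fin.≟ j)) (λ w → c x w Fin.≟ i)
          (λ w → proj₁) (λ w xw≡i → xw≡i , continues w xw≡i)
    where
    -- the path x → u → y back along the transpose of j transfers to every i-neighbour w of x
    continues : ∀ w → c x w ≡ i → c w u ≡ j
    continues w xw≡i with interNum→path (subst (0 <_) (regular (c x u) (c u y) x y x w (trans xy≡i (sym xw≡i)))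
                                                     (path→interNum u refl refl))
    ... | (u' , xu'≡xu , u'w≡uy) = trans (transpose u w u y (subst (λ z → c z w ≡ c u y) (unique u' xu'≡xu) u'w≡uy)) yu≡j

module HalfScheme {N k : ℕ} (c : Colouring N k) {m n r : ℕ} (mnr : IsMNRScheme c m n r) (red : IsReduced c)
                  (m≡2r : m ≡ 2 * r) {X Y : Fin k} (X-fib : IsFiber c X) (Y-fib : IsFiber c Y) (X≢Y : ¬ X ≡ Y) where
  open IsMNRScheme mnr
  open IsScheme scheme using (regular)
  open SchemeFacts c scheme

  -- All fibers have m > 0 points, so in-degree equals out-degree for relations between fibers.
  indeg≡deg : ∀ {X' Y' T x y} → InRel c X' Y' T → c x x ≡ X' → c y y ≡ Y' → indeg c y T ≡ deg c x T
  indeg≡deg {X'} {Y'} {T} {x} {y} T∈X'Y' x∈X' y∈Y' = sym (*-cancelˡ-≡ _ _ m {{>-nonZero m>0}} (begin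
      m * deg c x T        ≡⟨ cong (_* deg c x T) (fibSize X' (x , x∈X')) ⟨
      ∣ X' ∣ * deg c x T   ≡⟨ balance T∈X'Y' x∈X' y∈Y' ⟩
      ∣ Y' ∣ * indeg c y T ≡⟨ cong (_* indeg c y T) (fibSize Y' (y , y∈Y')) ⟩
      m * indeg c y T      ∎))
    where
    open ≡-Reasoning
    m>0 : 0 < m
    m>0 = subst (0 <_) (fibSize X' (x , x∈X')) (count-pos (λ w → c w w Fin.≟ X') x x∈X')

  -- Reducedness: no T ∈ ℛ_{X,Y} has valency 1, since it would be thin.
  deg-XY≢1 : ∀ {T x} → InRel c X Y T → c x x ≡ X → ¬ deg c x T ≡ 1
  deg-XY≢1 {T} {x} T∈XY x∈X dT≡1 = red X Y X-fib Y-fib X≢Y T T∈XY λ u v uv≡T →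
      let (u∈X , v∈Y) = T∈XY u v uv≡T in
      trans (deg-const T (trans u∈X (sym x∈X))) dT≡1 , trans (indeg≡deg T∈XY x∈X v∈Y) dT≡1

  deg-XY≥2 : ∀ {T x} → InRel c X Y T → c x x ≡ X → 2 ≤ deg c x T
  deg-XY≥2 T∈XY x∈X with m≤n⇒m<n∨m≡n (deg-pos T∈XY x∈X)
  ... | inj₁ 1<d = 1<d
  ... | inj₂ 1≡d = contradiction (sym 1≡d) (deg-XY≢1 T∈XY x∈X)

  -- Part (i): the r valencies d_T ≥ 2 (T ∈ ℛ_{X,Y}) add up to |Y| = m = 2r, so all equal 2.
  deg-XY≡2 : ∀ {T x} → InRel c X Y T → c x x ≡ X → deg c x T ≡ 2
  deg-XY≡2 {T} {x} T∈XY x∈X = sym (𝟙-*-cancel (I T) T∈XY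
      (sum-mono-≡ (λ T' → 𝟙-*-mono (I T') (λ T'∈XY → deg-XY≥2 T'∈XY x∈X)) sums T))
    where
    open ≡-Reasoning
    I : Decidable (InRel c X Y)
    I = inRel? c X Y
    sums : sum (λ T' → 𝟙 (I T') * 2) ≡ sum (λ T' → 𝟙 (I T') * deg c x T')
    sums = begin
      sum (λ T' → 𝟙 (I T') * 2)           ≡⟨ *-distribʳ-sum 2 (λ T' → 𝟙 (I T')) ⟨
      sum (λ T' → 𝟙 (I T')) * 2           ≡⟨ cong (_* 2) (count-sum I) ⟨
      count I * 2                          ≡⟨ cong (_* 2) (relCount X Y X-fib Y-fib) ⟩
      r * 2                                ≡⟨ *-comm r 2 ⟩
      2 * r                                ≡⟨ m≡2r ⟨
      m                                    ≡⟨ fibSize Y Y-fib ⟨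
      ∣ Y ∣                                ≡⟨ valency x∈X ⟨
      sum (λ T' → 𝟙 (I T') * deg c x T')  ∎

  -- Part (ii) for a fixed x ∈ X and R ∈ ℛ_X.  Fix an R-neighbour x' of x and y₀ ∈ Y, and
  -- count the paths x → w → z whose steps have the colours of (x, y₀) and (y₀, x').
  module InnerRelation {x R} (x∈X : c x x ≡ X) (R∈X : InRel c X X R) where
    d : ℕ
    d = deg c x R

    R-neighbour : ∃ λ x' → c x x' ≡ R
    R-neighbour = count-witness (λ w → c x w Fin.≟ R) (deg-pos R∈X x∈X)

    x' : Fin N
    x' = proj₁ R-neighbour

    y₀ : Fin N
    y₀ = proj₁ Y-fib

    paths : Fin N → ℕ
    paths z = interNum c (c x y₀) (c y₀ x') x z

    -- x has 2 neighbours w ∈ Y of colour c x y₀, each the source of 2 steps of colour c y₀ x'.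
    paths-total : sum paths ≡ 4
    paths-total = trans (paths-from second-steps) (cong (_* 2) (deg-XY≡2 (colour-InRel x∈X (proj₂ Y-fib)) x∈X))
      where
      x'∈X : c x' x' ≡ X
      x'∈X = proj₂ (R∈X x x' (proj₂ R-neighbour))
      second-steps : ∀ w → c x w ≡ c x y₀ → deg c w (c y₀ x') ≡ 2
      second-steps w xw≡xy₀ = let w∈Y = trans (target-fiber xw≡xy₀) (proj₂ Y-fib) in begin
        deg c w (c y₀ x')      ≡⟨ indeg≡deg-transpose w ⟨
        indeg c w (c x' y₀)    ≡⟨ indeg≡deg (colour-InRel x'∈X (proj₂ Y-fib)) x'∈X w∈Y ⟩
        deg c x' (c x' y₀)     ≡⟨ deg-XY≡2 (colour-InRel x'∈X (proj₂ Y-fib)) x'∈X ⟩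
        2                      ∎
        where open ≡-Reasoning

    paths-on-R : ∀ z → c x z ≡ R → paths z ≡ paths x'
    paths-on-R z xz≡R = regular _ _ x z x x' (trans xz≡R (sym (proj₂ R-neighbour)))

    paths-x'>0 : 0 < paths x'
    paths-x'>0 = path→interNum y₀ refl refl

    R-bound : d * paths x' ≤ 4
    R-bound = begin
      d * paths x'                                  ≡⟨ cong (_* paths x') (count-sum (λ z → c x z Fin.≟ R)) ⟩
      sum (λ z → 𝟙 (c x z Fin.≟ R)) * paths x'      ≡⟨ *-distribʳ-sum (paths x') (λ z → 𝟙 (c x z Fin.≟ R)) ⟩
      sum (λ z → 𝟙 (c x z Fin.≟ R) * paths x')      ≤⟨ sum-mono on-R ⟩
      sum paths                                     ≡⟨ paths-total ⟩
      4                                             ∎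
      where
      open ≤-Reasoning
      on-R : ∀ z → 𝟙 (c x z Fin.≟ R) * paths x' ≤ paths z
      on-R z with c x z Fin.≟ R
      ... | yes xz≡R = ≤-reflexive (trans (+-identityʳ _) (sym (paths-on-R z xz≡R)))
      ... | no  _    = z≤n

    d≤4 : d ≤ 4
    d≤4 = ≤-trans (m≤m*n d (paths x') {{>-nonZero paths-x'>0}}) R-bound

    -- Assuming d = 3: each R-neighbour receives exactly one path and a single path is left
    -- over; its end u is the only neighbour of x of colour c x u.
    module ThreeNeighbours (d≡3 : d ≡ 3) where
      on-R : ∀ z → c x z ≡ R → paths z ≡ 1
      on-R z xz≡R = trans (paths-on-R z xz≡R)
        (3*a≤4⇒a≡1 paths-x'>0 (subst (λ e → e * paths x' ≤ 4) d≡3 R-bound))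

      -- the paths not accounted for by the single path to each R-neighbour
      excess : Fin N → ℕ
      excess z = paths z ∸ 𝟙 (c x z Fin.≟ R)

      split : ∀ z → paths z ≡ 𝟙 (c x z Fin.≟ R) + excess z
      split z with c x z Fin.≟ R
      ... | yes xz≡R = sym (m+[n∸m]≡n (≤-reflexive (sym (on-R z xz≡R))))
      ... | no  _    = refl

      excess-total : sum excess ≡ 1
      excess-total = +-cancelˡ-≡ 3 _ _ (begin
        3 + sum excess                                   ≡⟨ cong (_+ sum excess) d≡3 ⟨
        d + sum excess                                   ≡⟨ cong (_+ sum excess) (count-sum (λ z → c x z Fin.≟ R)) ⟩
        sum (λ z → 𝟙 (c x z Fin.≟ R)) + sum excess       ≡⟨ ∑-distrib-+ (λ z → 𝟙 (c x z Fin.≟ R)) excess ⟨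
        sum (λ z → 𝟙 (c x z Fin.≟ R) + excess z)         ≡⟨ sum-cong-≗ split ⟨
        sum paths                                        ≡⟨ paths-total ⟩
        4                                                ∎)
        where open ≡-Reasoning

      off-R : ∀ z → ¬ c x z ≡ R → excess z ≡ paths z
      off-R z xz≢R = cong (paths z ∸_) (𝟙-no (c x z Fin.≟ R) xz≢R)

      single : ∃ λ u → excess u ≡ 1 × (∀ z → 0 < excess z → z ≡ u)
      single = sum≡1 excess excess-total

      u : Fin N
      u = proj₁ single

      u-off-R : ¬ c x u ≡ R
      u-off-R xu≡R = contradiction (proj₁ (proj₂ single))
        (subst (_≢ 1) (sym (cong₂ _∸_ (on-R u xu≡R) (𝟙-yes (c x u Fin.≟ R) xu≡R))) λ ())

      paths-u≡1 : paths u ≡ 1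
      paths-u≡1 = trans (sym (off-R u u-off-R)) (proj₁ (proj₂ single))

      -- any u' of the same colour also carries exactly one excess path, so u' = u
      u-unique : ∀ u' → c x u' ≡ c x u → u' ≡ u
      u-unique u' xu'≡xu = proj₂ (proj₂ single) u' (≤-reflexive (sym (begin
        excess u'  ≡⟨ off-R u' (λ xu'≡R → u-off-R (trans (sym xu'≡xu) xu'≡R)) ⟩
        paths u'   ≡⟨ regular _ _ x u' x u xu'≡xu ⟩
        paths u    ≡⟨ paths-u≡1 ⟩
        1          ∎)))
        where open ≡-Reasoning

    -- d = 3 is impossible: by unique-target, all d_{c x y₀} = 2 paths leaving x along c x y₀
    -- would end at the point u, which receives only one.
    d≢3 : d ≢ 3
    d≢3 d≡3 = contradiction paths-u≡2 (subst (_≢ 2) (sym paths-u≡1) λ ())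
      where
      open ThreeNeighbours d≡3
      paths-u≡2 : paths u ≡ 2
      paths-u≡2 = trans (unique-target u-unique (≤-reflexive (sym paths-u≡1)))
                        (deg-XY≡2 (colour-InRel x∈X (proj₂ Y-fib)) x∈X)

    deg-124 : d ≡ 1 ⊎ d ≡ 2 ⊎ d ≡ 4
    deg-124 = one-two-four (deg-pos R∈X x∈X) d≤4 d≢3

  -- Part (ii), counting: summing the weights over ℛ_X gives 2r + 2·#{d_R = 4} = m + #{d_R = 1},
  -- since ℛ_X has r members whose valencies add up to |X| = m = 2r.
  ones≡2*fours : ∀ {x} → c x x ≡ X
    → count (λ R → inRel? c X X R ×-dec (deg c x R ≟ 1)) ≡ 2 * count (λ R → inRel? c X X R ×-dec (deg c x R ≟ 4))
  ones≡2*fours {x} x∈X = sym (+-cancelˡ-≡ (2 * r) _ _ (begin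
      2 * r + 2 * count four
    ≡⟨ cong₂ (λ a b → 2 * a + 2 * b) (trans (sym (relCount X X X-fib X-fib)) (count-sum I)) (count-sum four) ⟩
      2 * sum (λ R → 𝟙 (I R)) + 2 * sum (λ R → 𝟙 (four R))
    ≡⟨ cong₂ _+_ (*-distribˡ-sum 2 (λ R → 𝟙 (I R))) (*-distribˡ-sum 2 (λ R → 𝟙 (four R))) ⟩
      sum (λ R → 2 * 𝟙 (I R)) + sum (λ R → 2 * 𝟙 (four R))
    ≡⟨ ∑-distrib-+ (λ R → 2 * 𝟙 (I R)) (λ R → 2 * 𝟙 (four R)) ⟨
      sum (λ R → 2 * 𝟙 (I R) + 2 * 𝟙 (four R))
    ≡⟨ sum-cong-≗ (λ R → valency-weights (I R) (deg c x R) (λ R∈X → InnerRelation.deg-124 x∈X R∈X)) ⟩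
      sum (λ R → 𝟙 (I R) * deg c x R + 𝟙 (one R))
    ≡⟨ ∑-distrib-+ (λ R → 𝟙 (I R) * deg c x R) (λ R → 𝟙 (one R)) ⟩
      sum (λ R → 𝟙 (I R) * deg c x R) + sum (λ R → 𝟙 (one R))
    ≡⟨ cong₂ _+_ (trans (valency {Y = X} x∈X) (trans (fibSize X X-fib) m≡2r)) (sym (count-sum one)) ⟩
      2 * r + count one
    ∎))
    where
    open ≡-Reasoning
    I : Decidable (InRel c X X)
    I = inRel? c X X
    one : Decidable (λ R → InRel c X X R × deg c x R ≡ 1)
    one R = I R ×-dec (deg c x R ≟ 1)
    four : Decidable (λ R → InRel c X X R × deg c x R ≡ 4)
    four R = I R ×-dec (deg c x R ≟ 4)

lemma18 : ∀ {N k : ℕ} (c : Colouring N k) (m n r : ℕ)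
    → IsMNRScheme c m n r → IsReduced c → m ≡ 2 * r
    → ∀ X Y → IsFiber c X → IsFiber c Y → ¬ (X ≡ Y)
    → (∀ T → InRel c X Y T → ∀ x → _∈F_ c x X → deg c x T ≡ 2)
      × (∀ x → _∈F_ c x X
          → (∀ R → InRel c X X R → (deg c x R ≡ 1) ⊎ (deg c x R ≡ 2) ⊎ (deg c x R ≡ 4))
            × (count (λ R → inRel? c X X R ×-dec (deg c x R ≟ 1))
               ≡ 2 * count (λ R → inRel? c X X R ×-dec (deg c x R ≟ 4))))
lemma18 c m n r mnr red m≡2r X Y X-fib Y-fib X≢Y =
    (λ T T∈XY x x∈X → deg-XY≡2 T∈XY x∈X)
  , (λ x x∈X → (λ R R∈X → InnerRelation.deg-124 x∈X R∈X) , ones≡2*fours x∈X)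
  where open HalfScheme c mnr red m≡2r X-fib Y-fib X≢Y
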